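{- Let $G$ be a graph and let $v\in V(G)$. Then $v$ is $\operatorname{Z}$-irrelevant (i.e., $v$ is not contained in any minimal zero forcing set of $G$) if and only if $v$ is not contained in any minimal fort of $G$.
   Context: All graphs are simple, undirected, finite, with nonempty vertex set. Zero forcing: starting from a set $B$ of blue vertices (all others white), repeatedly apply the color change rule: a blue vertex $u$ may change a white vertex $w$ to blue if $w$ is the only white neighbor of $u$. $B$ is a zero forcing set if eventually all vertices become blue. A minimal zero forcing set is one with no proper subset that is a zero forcing set. A fort of $G$ is a nonempty set $F\subseteq V(G)$ such that every $v\in V(G)\setminus F$ satisfies $|F\cap N(v)|\neq 1$, where $N(v)$ is the open neighborhood of $v$. A minimal fort is a fort that does not properly contain another fort. -}

module Defs where

open import Data.Nat using (ℕ; suc)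
open import Data.Fin using (Fin)
open import Data.Fin.Subset using (Subset; _∈_; _∉_; _⊆_; _⊂_; Nonempty; _∩_; ∣_∣)
open import Data.Vec using (tabulate)
open import Data.Product using (_×_; Σ)
open import Relation.Nullary using (¬_)
open import Relation.Binary.PropositionalEquality using (_≡_; _≢_)

record Graph (n : ℕ) : Set₁ where
  field
    Adj       : Fin n → Fin n → Set
    sym       : ∀ {u v} → Adj u v → Adj v u
    irrefl    : ∀ {u} → ¬ Adj u u
    decAdj    : ∀ u v → Relation.Nullary.Dec (Adj u v)
open Graph public

N : ∀ {n} (G : Graph n) → Fin n → Subset n
N G v = tabulate (λ w → Relation.Nullary.Decidable.⌊ decAdj G v w ⌋)
  where import Relation.Nullary.Decidable

-- Final set of blue vertices reached from B by repeated application of the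
-- colour change rule: u blue, w the only white neighbour of u ⇒ w becomes blue.
-- (The final colouring is independent of the order of forces; this is its
-- inductive characterisation as a least closed set.)
data Blue {n} (G : Graph n) (B : Subset n) : Fin n → Set where
  init  : ∀ {v} → v ∈ B → Blue G B v
  force : ∀ {u w} → Blue G B u → Adj G u w
        → (∀ x → Adj G u x → x ≢ w → Blue G B x)
        → Blue G B w

IsZeroForcingSet : ∀ {n} → Graph n → Subset n → Set
IsZeroForcingSet G B = ∀ v → Blue G B v

IsMinimalZeroForcingSet : ∀ {n} → Graph n → Subset n → Set
IsMinimalZeroForcingSet G B =
  IsZeroForcingSet G B × (∀ B' → B' ⊂ B → ¬ IsZeroForcingSet G B')

IsFort : ∀ {n} → Graph n → Subset n → Set
IsFort G F = Nonempty F × (∀ v → v ∉ F → ∣ F ∩ N G v ∣ ≢ 1)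

IsMinimalFort : ∀ {n} → Graph n → Subset n → Set
IsMinimalFort G F = IsFort G F × (∀ F' → F' ⊂ F → ¬ IsFort G F')

ZIrrelevant : ∀ {n} → Graph n → Fin n → Set
ZIrrelevant G v = ∀ B → IsMinimalZeroForcingSet G B → v ∉ B

{-# OPTIONS --safe #-}
-- A set B is zero forcing iff it meets every fort. A fort F disjoint from B is never
-- forced, since a blue vertex outside F has either no neighbour or at least two white
-- neighbours in F; conversely the vertices still white when forcing stops form a fort.
-- So if v lies in a minimal zero forcing set B, then B - v misses some fort, hence some
-- minimal fort, and that minimal fort can meet B only in v. If v lies in a minimal
-- fort F, then (V ∖ F) ∪ {v} is zero forcing, because a fort it misses would be a
-- fort properly inside F; any minimal zero forcing subset of it meets F, necessarily in v.
--
-- Membership in the final blue set is not decidable from the inductive definition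
-- alone, but every goal here is a negation, so the argument runs in the
-- double-negation monad, where excluded middle is available.
module Submission where

open import Defs hiding (sym)
open import Data.Bool.Properties using (T-≡)
open import Data.Nat using (ℕ; suc)
import Data.Nat.Properties as ℕ
open import Data.Fin using (Fin; zero; suc)
open import Data.Fin.Properties using (_≟_; ¬∀⟶∃¬; sequence)
open import Data.Fin.Subset
  using (Subset; _∈_; _∉_; _⊆_; _⊂_; Nonempty; _∩_; _∪_; ∁; _-_; ⁅_⁆; ∣_∣; inside; outside)
open import Data.Fin.Subset.Properties
  using ( _∈?_; ⊆-refl; ⊆-trans; ⊆-antisym; p⊂q⇒p⊆q; x∈⁅x⁆; x∈⁅y⁆⇒x≡y; ∣⁅x⁆∣≡1
        ; x∈p∩q⁺; x∈p∩q⁻; x∈p∪q⁺; x∈p∪q⁻; x∈∁p⇒x∉p; x∉∁p⇒x∈p; x∈p⇒p-x⊂p; x∈p∧x≢y⇒x∈p-y)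
open import Data.Fin.Subset.Induction using (⊂-wellFounded)
open import Data.Product using (_×_; ∃; _,_; proj₁)
open import Data.Sum using (inj₁; inj₂)
open import Data.Vec using (tabulate; lookup; _∷_; here; there)
open import Data.Vec.Properties using (lookup∘tabulate; []=⇒lookup; lookup⇒[]=)
open import Effect.Monad using (RawMonad)
open import Function using (_∘_; case_of_; Equivalence)
open import Induction.WellFounded using (Acc; acc)
open import Level using (0ℓ)
open import Relation.Binary.PropositionalEquality using (_≡_; _≢_; refl; sym; trans; cong; subst)
open import Relation.Nullary using (¬_; yes; no; ¬?)
open import Relation.Nullary.Decidable
  using (⌊_⌋; toWitness; fromWitness; decidable-stable; ¬¬-excluded-middle)
open import Relation.Nullary.Negation using (¬¬-Monad; contradiction)
open import Relation.Unary using (Pred; Decidable)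

open RawMonad (¬¬-Monad {a = 0ℓ})

private
  variable
    n : ℕ
    x : Fin n
    p B F : Subset n

Minimal : (Subset n → Set) → Subset n → Set
Minimal P S = P S × (∀ S' → S' ⊂ S → ¬ P S')

Disjoint : Subset n → Subset n → Set
Disjoint p q = ∀ {x} → x ∈ p → x ∉ q

¬¬-decidable : (P : Pred (Fin n) 0ℓ) → ¬ ¬ Decidable P
¬¬-decidable P = sequence rawApplicative (λ _ → ¬¬-excluded-middle)

select : {P : Pred (Fin n) 0ℓ} → Decidable P → Subset n
select P? = tabulate (⌊_⌋ ∘ P?)

module _ {P : Pred (Fin n) 0ℓ} (P? : Decidable P) where

  lookup-select : ∀ x → lookup (select P?) x ≡ ⌊ P? x ⌋
  lookup-select = lookup∘tabulate (⌊_⌋ ∘ P?)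

  ∈-select⁺ : P x → x ∈ select P?
  ∈-select⁺ {x} px =
    lookup⇒[]= x (select P?) (trans (lookup-select x) (Equivalence.to T-≡ (fromWitness px)))

  ∈-select⁻ : x ∈ select P? → P x
  ∈-select⁻ {x} x∈ =
    toWitness (Equivalence.from T-≡ (trans (sym (lookup-select x)) ([]=⇒lookup x∈)))

∣p∣≡0⇒x∉p : ∀ (p : Subset n) → ∣ p ∣ ≡ 0 → x ∉ p
∣p∣≡0⇒x∉p (outside ∷ p) e (there x∈p) = ∣p∣≡0⇒x∉p p e x∈p

∣p∣≡1⇒∃! : ∀ (p : Subset n) → ∣ p ∣ ≡ 1 → ∃ λ x → x ∈ p × (∀ {y} → y ∈ p → y ≡ x)
∣p∣≡1⇒∃! (inside ∷ p) e = zero , here , unique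
  where
  unique : ∀ {y} → y ∈ inside ∷ p → y ≡ zero
  unique here          = refl
  unique (there y∈p) = contradiction y∈p (∣p∣≡0⇒x∉p p (ℕ.suc-injective e))
∣p∣≡1⇒∃! (outside ∷ p) e with ∣p∣≡1⇒∃! p e
... | x , x∈p , unique = suc x , there x∈p , λ { (there y∈p) → cong suc (unique y∈p) }

∃!⇒∣p∣≡1 : x ∈ p → (∀ {y} → y ∈ p → y ≡ x) → ∣ p ∣ ≡ 1
∃!⇒∣p∣≡1 {x = x} {p} x∈p unique = trans (cong ∣_∣ p≡⁅x⁆) (∣⁅x⁆∣≡1 x)
  where
  p≡⁅x⁆ : p ≡ ⁅ x ⁆
  p≡⁅x⁆ = ⊆-antisym (λ y∈p → subst (_∈ ⁅ x ⁆) (sym (unique y∈p)) (x∈⁅x⁆ x))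
                    (λ y∈⁅x⁆ → subst (_∈ p) (sym (x∈⁅y⁆⇒x≡y x y∈⁅x⁆)) x∈p)

¬¬-minimal-⊆ : ∀ {S : Subset n} (P : Subset n → Set) →
               P S → ¬ ¬ ∃ λ S' → S' ⊆ S × Minimal P S'
¬¬-minimal-⊆ {n} P = below (⊂-wellFounded _)
  where
  MinimalBelow : Subset n → Set
  MinimalBelow S = ∃ λ S' → S' ⊆ S × Minimal P S'

  below : ∀ {S} → Acc _⊂_ S → P S → ¬ ¬ MinimalBelow S
  below {S} (acc smaller) pS = do
    yes (S' , S'⊂S , pS') ← ¬¬-excluded-middle {A = ∃ λ S' → S' ⊂ S × P S'}
      where no none → pure {A = MinimalBelow S}
                              (S , ⊆-refl , pS , λ S' S'⊂S pS' → none (S' , S'⊂S , pS'))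
    (S'' , S''⊆S' , minimal) ← below (smaller S'⊂S) pS'
    pure {A = MinimalBelow S} (S'' , ⊆-trans S''⊆S' (p⊂q⇒p⊆q S'⊂S) , minimal)

module _ (G : Graph n) where

  ∈-N⁺ : ∀ {u w} → Adj G u w → w ∈ N G u
  ∈-N⁺ {u} = ∈-select⁺ (decAdj G u)

  ∈-N⁻ : ∀ {u w} → w ∈ N G u → Adj G u w
  ∈-N⁻ {u} = ∈-select⁻ (decAdj G u)

  fort-stays-white : IsFort G F → Disjoint B F → Blue G B x → x ∉ F
  fort-stays-white _ B#F (init x∈B) = B#F x∈B
  fort-stays-white {F = F} fort@(_ , closed) B#F (force {u} {w} u-blue u~w others-blue) w∈F =
    closed u (fort-stays-white fort B#F u-blue) (∃!⇒∣p∣≡1 (x∈p∩q⁺ (w∈F , ∈-N⁺ u~w)) only-w)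
    where
    only-w : ∀ {y} → y ∈ F ∩ N G u → y ≡ w
    only-w {y} y∈F∩N with x∈p∩q⁻ F (N G u) y∈F∩N
    ... | y∈F , y∈N = decidable-stable (y ≟ w) λ y≢w →
      fort-stays-white fort B#F (others-blue y (∈-N⁻ y∈N) y≢w) y∈F

  zeroForcingSet-meets-fort : IsZeroForcingSet G B → IsFort G F → ¬ Disjoint B F
  zeroForcingSet-meets-fort zfs fort@((x , x∈F) , _) B#F = fort-stays-white fort B#F (zfs x) x∈F

  module _ {B : Subset n} (blue? : Decidable (Blue G B)) where

    white : Subset n
    white = select (¬? ∘ blue?)

    ∉white⇒blue : x ∉ white → Blue G B x
    ∉white⇒blue {x} x∉white = decidable-stable (blue? x) (x∉white ∘ ∈-select⁺ (¬? ∘ blue?))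

    white-disjoint : Disjoint B white
    white-disjoint x∈B x∈white = ∈-select⁻ (¬? ∘ blue?) x∈white (init x∈B)

    white-isFort : ¬ IsZeroForcingSet G B → IsFort G white
    white-isFort not-zfs = nonempty , closed
      where
      nonempty : Nonempty white
      nonempty with ¬∀⟶∃¬ _ (Blue G B) blue? not-zfs
      ... | x , x-white = x , ∈-select⁺ (¬? ∘ blue?) x-white

      closed : ∀ y → y ∉ white → ∣ white ∩ N G y ∣ ≢ 1
      closed y y∉white one with ∣p∣≡1⇒∃! (white ∩ N G y) one
      ... | w , w∈white∩N , only-w with x∈p∩q⁻ white (N G y) w∈white∩N
      ... | w∈white , w∈N =
        ∈-select⁻ (¬? ∘ blue?) w∈white (force (∉white⇒blue y∉white) (∈-N⁻ w∈N) others-blue)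
        where
        others-blue : ∀ x → Adj G y x → x ≢ w → Blue G B x
        others-blue x y~x x≢w = ∉white⇒blue λ x∈white → x≢w (only-w (x∈p∩q⁺ (x∈white , ∈-N⁺ y~x)))

  ¬zeroForcingSet⇒¬¬disjoint-fort : ¬ IsZeroForcingSet G B → ¬ ¬ ∃ λ F → IsFort G F × Disjoint B F
  ¬zeroForcingSet⇒¬¬disjoint-fort {B = B} not-zfs = do
    blue? ← ¬¬-decidable (Blue G B)
    pure (white blue? , white-isFort blue? not-zfs , λ {x} → white-disjoint blue? {x})

  minimalZeroForcingSet-member⇒¬¬minimalFort-member :
    ∀ {v} → IsMinimalZeroForcingSet G B → v ∈ B → ¬ ¬ ∃ λ F → IsMinimalFort G F × v ∈ F
  minimalZeroForcingSet-member⇒¬¬minimalFort-member {B = B} {v} (zfs , minimal) v∈B = do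
    (F' , F'-fort , B-v#F') ← ¬zeroForcingSet⇒¬¬disjoint-fort (minimal (B - v) (x∈p⇒p-x⊂p v∈B))
    (F , F⊆F' , F-minimal) ← ¬¬-minimal-⊆ (IsFort G) F'-fort
    pure (F , F-minimal , v∈F F⊆F' B-v#F' (proj₁ F-minimal))
    where
    v∈F : ∀ {F F'} → F ⊆ F' → Disjoint (B - v) F' → IsFort G F → v ∈ F
    v∈F {F} F⊆F' B-v#F' F-fort = decidable-stable (v ∈? F) λ v∉F →
      zeroForcingSet-meets-fort zfs F-fort λ {x} x∈B x∈F →
        B-v#F' (x∈p∧x≢y⇒x∈p-y x∈B λ { refl → v∉F x∈F }) (F⊆F' x∈F)

  minimalFort-member⇒¬¬minimalZeroForcingSet-member :
    ∀ {v} → IsMinimalFort G F → v ∈ F → ¬ ¬ ∃ λ B → IsMinimalZeroForcingSet G B × v ∈ B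
  minimalFort-member⇒¬¬minimalZeroForcingSet-member {F = F} {v} (F-fort , minimal) v∈F = do
    B₀-zfs ← ¬¬B₀-zeroForcing
    (B , B⊆B₀ , B-minimal) ← ¬¬-minimal-⊆ (IsZeroForcingSet G) B₀-zfs
    pure (B , B-minimal , v∈B B⊆B₀ (proj₁ B-minimal))
    where
    B₀ : Subset _
    B₀ = ∁ F ∪ ⁅ v ⁆

    disjoint-from-B₀⇒⊂F : ∀ {F'} → Disjoint B₀ F' → F' ⊂ F
    disjoint-from-B₀⇒⊂F B₀#F' =
        (λ x∈F' → x∉∁p⇒x∈p λ x∈∁F → B₀#F' (x∈p∪q⁺ (inj₁ x∈∁F)) x∈F')
      , v , v∈F , B₀#F' (x∈p∪q⁺ (inj₂ (x∈⁅x⁆ v)))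

    ¬¬B₀-zeroForcing : ¬ ¬ IsZeroForcingSet G B₀
    ¬¬B₀-zeroForcing not-zfs = ¬zeroForcingSet⇒¬¬disjoint-fort not-zfs λ (F' , F'-fort , B₀#F') →
      minimal F' (disjoint-from-B₀⇒⊂F B₀#F') F'-fort

    v∈B : ∀ {B} → B ⊆ B₀ → IsZeroForcingSet G B → v ∈ B
    v∈B {B} B⊆B₀ zfs = decidable-stable (v ∈? B) λ v∉B →
      zeroForcingSet-meets-fort zfs F-fort λ {x} x∈B x∈F → case x∈p∪q⁻ (∁ F) ⁅ v ⁆ (B⊆B₀ x∈B) of λ
        { (inj₁ x∈∁F) → x∈∁p⇒x∉p x∈∁F x∈F
        ; (inj₂ x∈⁅v⁆) → v∉B (subst (_∈ B) (x∈⁅y⁆⇒x≡y v x∈⁅v⁆) x∈B) }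

proposition1p7 : ∀ (n : ℕ) (G : Graph (suc n)) (v : Fin (suc n))
    → (ZIrrelevant G v → (∀ F → IsMinimalFort G F → v ∉ F))
    × ((∀ F → IsMinimalFort G F → v ∉ F) → ZIrrelevant G v)
proposition1p7 n G v =
    (λ irrelevant F F-minimal v∈F →
       minimalFort-member⇒¬¬minimalZeroForcingSet-member G F-minimal v∈F
         λ (B , B-minimal , v∈B) → irrelevant B B-minimal v∈B)
  , (λ in-no-minimal-fort B B-minimal v∈B →
       minimalZeroForcingSet-member⇒¬¬minimalFort-member G B-minimal v∈B
         λ (F , F-minimal , v∈F) → in-no-minimal-fort F F-minimal v∈F)
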